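{- Let $W$ be a $4$-dimensional left vector space over a division ring, and let $X=\{x_1,\dots,x_5\}\subset W$ and $Y=\{y^{*}_1,\dots,y^{*}_5\}\subset W^{*}$ be $4$-independent $5$-element subsets. Let $U_i\subset W$ be the annihilator of $y^{*}_i$, and assume: every $U_i$ is spanned by a subset of $X$, and every $\langle x_i\rangle$ is the intersection of some of the $U_j$. Let $\mathcal{Z}=\mathcal{J}_2(X)\cap\mathcal{J}^{*}_2(Y)$. Then $|\mathcal{Z}|\le 5<7=a(5,2)$, where $a(n,k)=\binom{n-2}{k-2}+\binom{n-1}{k}$.
   Context: A subset of a vector space is $4$-independent if each of its $4$-element subsets is linearly independent. $\mathcal{J}_2(X)$ is the set of $2$-dimensional subspaces of $W$ spanned by $2$-element subsets of $X$. $\mathcal{J}^{*}_2(Y)$ is the set of annihilators in $W$ (identifying $W^{**}$ with $W$) of the $2$-dimensional subspaces of $W^{*}$ spanned by $2$-element subsets of $Y$. -}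

module Defs where

import Level
open Level using (Level; _⊔_) renaming (suc to lsuc)
open import Algebra.Bundles using (Ring)
open import Data.Fin using (Fin; zero; suc)
open import Data.Fin.Subset using (Subset; _∈_; _∉_)
import Data.Nat
open Data.Nat using (ℕ)
open import Data.Nat.Combinatorics using (_C_)
open import Data.Product using (Σ; ∃; _×_; _,_; proj₁; proj₂)
open import Relation.Nullary using (¬_)
open import Relation.Binary.PropositionalEquality using (_≡_)
open import Function.Definitions using (Injective)

record DivisionRing (c ℓ : Level) : Set (lsuc (c ⊔ ℓ)) where
  field
    ring : Ring c ℓ
  open Ring ring public
  field
    1≉0     : ¬ (1# ≈ 0#)
    inverse : ∀ x → ¬ (x ≈ 0#) → Σ Carrier λ y → (x * y ≈ 1#) × (y * x ≈ 1#)

a : ℕ → ℕ → ℕ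
a n k = ((n Data.Nat.∸ 2) C (k Data.Nat.∸ 2)) Data.Nat.+ ((n Data.Nat.∸ 1) C k)

module LinAlg {c ℓ : Level} (D : DivisionRing c ℓ) where
  open DivisionRing D using (Carrier; _≈_; _+_; _*_; 0#)

  -- W = D⁴, a 4-dimensional LEFT vector space over D (left scalar multiplication).
  -- Every 4-dimensional left vector space over D is isomorphic to this one.
  W : Set c
  W = Fin 4 → Carrier

  -- W* = Hom_D(W , D), realised as coordinate vectors f with
  --   ⟨ w , f ⟩ = Σᵢ wᵢ * fᵢ ;  W* is a RIGHT vector space, (f·a)ᵢ = fᵢ * a,
  -- so that ⟨ w , f·a ⟩ = ⟨ w , f ⟩ * a.
  W* : Set c
  W* = Fin 4 → Carrier

  Σ4 : (Fin 4 → Carrier) → Carrier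
  Σ4 g = g zero + (g (suc zero) + (g (suc (suc zero)) + g (suc (suc (suc zero)))))

  Σ5 : (Fin 5 → Carrier) → Carrier
  Σ5 g = g zero + Σ4 (λ i → g (suc i))

  _≈W_ : W → W → Set ℓ
  v ≈W w = ∀ i → v i ≈ w i

  _+W_ : W → W → W
  (v +W w) i = v i + w i

  _·W_ : Carrier → W → W
  (r ·W v) i = r * v i

  _*·_ : W* → Carrier → W*
  (f *· r) i = f i * r

  _+*_ : W* → W* → W*
  (f +* g) i = f i + g i

  0W : W
  0W _ = 0#

  ⟨_,_⟩ : W → W* → Carrier
  ⟨ w , f ⟩ = Σ4 (λ i → w i * f i)

  lincomb5 : (Fin 5 → Carrier) → (Fin 5 → W) → W
  lincomb5 c v i = Σ5 (λ j → c j * v j i)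

  lincomb4 : (Fin 4 → Carrier) → (Fin 4 → W) → W
  lincomb4 c v i = Σ4 (λ j → c j * v j i)

  LinIndep4 : (Fin 4 → W) → Set (c ⊔ ℓ)
  LinIndep4 v = ∀ (cs : Fin 4 → Carrier) → lincomb4 cs v ≈W 0W → ∀ j → cs j ≈ 0#

  -- same for functionals (W* is a right space, so coefficients act on the right)
  lincomb4* : (Fin 4 → W*) → (Fin 4 → Carrier) → W*
  lincomb4* v cs i = Σ4 (λ j → v j i * cs j)

  LinIndep4* : (Fin 4 → W*) → Set (c ⊔ ℓ)
  LinIndep4* v = ∀ (cs : Fin 4 → Carrier) → (∀ i → lincomb4* v cs i ≈ 0#) → ∀ j → cs j ≈ 0#

  -- a 5-element family (a 5-element subset: pairwise distinct members) that is 4-independent: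
  -- each 4-element subfamily is linearly independent
  FourIndependent : (Fin 5 → W) → Set (c ⊔ ℓ)
  FourIndependent x =
    (∀ i j → x i ≈W x j → i ≡ j) ×
    (∀ (s : Fin 4 → Fin 5) → Injective _≡_ _≡_ s → LinIndep4 (λ k → x (s k)))

  FourIndependent* : (Fin 5 → W*) → Set (c ⊔ ℓ)
  FourIndependent* y =
    (∀ i j → (∀ k → y i k ≈ y j k) → i ≡ j) ×
    (∀ (s : Fin 4 → Fin 5) → Injective _≡_ _≡_ s → LinIndep4* (λ k → y (s k)))

  Pred : Set (lsuc (c ⊔ ℓ))
  Pred = W → Set (c ⊔ ℓ)

  _≐_ : Pred → Pred → Set (c ⊔ ℓ)
  P ≐ Q = (∀ w → P w → Q w) × (∀ w → Q w → P w)

  SpanOf : (Fin 5 → W) → Subset 5 → Pred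
  SpanOf x S w = Σ (Fin 5 → Carrier) λ cs → (∀ j → j ∉ S → cs j ≈ 0#) × (w ≈W lincomb5 cs x)

  Span2 : W → W → Pred
  Span2 u v w = Σ Carrier λ r → Σ Carrier λ s → w ≈W ((r ·W u) +W (s ·W v))

  Span1 : W → Pred
  Span1 u w = Σ Carrier λ r → w ≈W (r ·W u)

  Span2* : W* → W* → W* → Set (c ⊔ ℓ)
  Span2* f g h = Σ Carrier λ r → Σ Carrier λ s → ∀ i → h i ≈ ((f *· r) +* (g *· s)) i

  -- annihilator in W of a set of functionals (W** identified with W)
  Ann : (W* → Set (c ⊔ ℓ)) → Pred
  Ann F w = ∀ h → F h → ⟨ w , h ⟩ ≈ 0#

  Ann1 : W* → Pred
  Ann1 f w = Level.Lift c (⟨ w , f ⟩ ≈ 0#)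

  -- ⋂_{j ∈ T} U_j  with U_j = Ann1 (y j)  (empty intersection = W)
  InterAnn : (Fin 5 → W*) → Subset 5 → Pred
  InterAnn y T w = ∀ j → j ∈ T → Ann1 (y j) w

  InZ : (Fin 5 → W) → (Fin 5 → W*) → Fin 5 → Fin 5 → Set (c ⊔ ℓ)
  InZ x y i j = ¬ (i ≡ j) × Σ (Fin 5) λ k → Σ (Fin 5) λ l →
                  ¬ (k ≡ l) × (Span2 (x i) (x j) ≐ Ann (Span2* (y k) (y l)))

  -- |𝒵| ≤ 5 : there are no 6 pairwise distinct members of 𝒵
  -- (every member of 𝒥₂(X) is Span2 (x i) (x j) for some i ≢ j)
  ZAtMostFive : (Fin 5 → W) → (Fin 5 → W*) → Set (c ⊔ ℓ)
  ZAtMostFive x y =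
    ¬ (Σ (Fin 6 → Fin 5 × Fin 5) λ f →
         (∀ p → InZ x y (proj₁ (f p)) (proj₂ (f p))) ×
         (∀ p q → ¬ (p ≡ q) →
            ¬ (Span2 (x (proj₁ (f p))) (x (proj₂ (f p))) ≐ Span2 (x (proj₁ (f q))) (x (proj₂ (f q))))))

{-# OPTIONS --safe #-}
-- Write U_k = span {x_j | j ∈ S k}. Since every four of the x_j form a basis, comparing
-- coefficients shows that S k = {j | ⟨x_j, y_k⟩ = 0} and that at most two indices lie outside
-- S k (some nonzero combination of any two x_j lies in the hyperplane U_k). If ⟨x_i, x_j⟩ is the
-- annihilator of ⟨y_k, y_l⟩, then i and j lie in S k and in S l; as no x_i is annihilated by four
-- of the y's, counting gives an m with i, j ∉ S m, so {i, j} is the complement of S m. Hence a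
-- member of 𝒵 is determined by an index m among five, and six distinct members contradict the
-- pigeonhole principle. The linear algebra needed is that a nonzero functional on D⁴ does not
-- vanish on four independent vectors, which follows from Gaussian elimination (five vectors in
-- D⁴ are dependent).
module Submission where

open import Defs
open import Level using (Level; _⊔_; lower; lift)
open import Algebra.Bundles using (Ring)
import Algebra.Construct.Flip.Op as Op
open import Data.Empty using (⊥; ⊥-elim)
open import Data.Fin using (Fin; zero; suc; #_; punchIn; punchOut; _≟_)
open import Data.Fin.Properties
  using (punchIn-injective; punchInᵢ≢i; punchIn-punchOut; any?; pigeonhole; <⇒≢)
open import Data.Fin.Subset using (Subset; _∈_; _∉_)
open import Data.Fin.Subset.Properties using (_∈?_)
open import Data.Nat using (ℕ; _<_)
open import Data.Nat.Properties using (n<1+n; n≤1+n)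
open import Data.Product using (Σ; ∃; ∃₂; _×_; _,_; proj₁; proj₂)
open import Data.Sum using (_⊎_; inj₁; inj₂)
open import Data.Vec using ([]; _∷_; lookup)
open import Data.Vec.Functional using (Vector; removeAt; insertAt)
import Data.Vec.Functional as Vector
open import Data.Vec.Functional.Properties using (insertAt-lookup; insertAt-punchIn; removeAt-punchOut)
open import Data.Vec.Relation.Unary.All using ([]; _∷_)
open import Data.Vec.Relation.Unary.All.Properties using (lookup⁺)
open import Data.Vec.Relation.Unary.AllPairs using ([]; _∷_)
open import Data.Vec.Relation.Unary.Unique.Propositional using (Unique)
open import Data.Vec.Relation.Unary.Unique.Propositional.Properties using (lookup-injective)
open import Function using (_∘_)
open import Function.Definitions using (Injective)
open import Relation.Binary.PropositionalEquality using (_≡_; _≢_)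
import Relation.Binary.PropositionalEquality as ≡
open import Relation.Nullary using (¬_; yes; no)
open import Relation.Nullary.Decidable using (¬¬-excluded-middle; decidable-stable; ¬?; _×-dec_)
open import Relation.Unary using (Decidable)

¬¬-∀-Fin : ∀ {a} n {Q : Fin n → Set a} → (∀ i → ¬ ¬ Q i) → ¬ ¬ (∀ i → Q i)
¬¬-∀-Fin ℕ.zero    h k = k λ ()
¬¬-∀-Fin (ℕ.suc n) h k = h zero λ q₀ → ¬¬-∀-Fin n (h ∘ suc) λ qs → k λ { zero → q₀ ; (suc i) → qs i }

module LinearCombinations {c ℓ : Level} (R : Ring c ℓ) where
  open Ring R hiding (zero)
  open import Algebra.Properties.Ring R using (-1*x≈-x; [y-z]x≈yx-zx; x∙y⁻¹≈ε⇒x≈y; x≈y⇒x∙y⁻¹≈ε)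
  open import Algebra.Properties.Semiring.Sum semiring
    using (sum-syntax; sum-cong-≋; sum-replicate-zero; sum-remove;
           ∑-distrib-+; ∑-comm; *-distribˡ-sum; *-distribʳ-sum)
  open import Relation.Binary.Reasoning.Setoid setoid

  ∑-zero : ∀ {n} (f : Vector Carrier n) → (∀ i → f i ≈ 0#) → ∑[ i < n ] f i ≈ 0#
  ∑-zero {n} f f≈0 = trans (sum-cong-≋ f≈0) (sum-replicate-zero n)

  ∑-neg : ∀ {n} (f : Vector Carrier n) → ∑[ i < n ] (- f i) ≈ - ∑[ i < n ] f i
  ∑-neg {n} f = begin
    ∑[ i < n ] (- f i)      ≈⟨ sum-cong-≋ (λ i → -1*x≈-x (f i)) ⟨
    ∑[ i < n ] (- 1# * f i) ≈⟨ *-distribˡ-sum (- 1#) f ⟨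
    - 1# * ∑[ i < n ] f i   ≈⟨ -1*x≈-x _ ⟩
    - ∑[ i < n ] f i        ∎

  δ : ∀ {n} → Fin n → Fin n → Carrier
  δ zero    zero    = 1#
  δ zero    (suc _) = 0#
  δ (suc _) zero    = 0#
  δ (suc i) (suc j) = δ i j

  δ-diag : ∀ {n} (i : Fin n) → δ i i ≈ 1#
  δ-diag zero    = refl
  δ-diag (suc i) = δ-diag i

  δ-offdiag : ∀ {n} {i j : Fin n} → i ≢ j → δ i j ≈ 0#
  δ-offdiag {i = zero}  {zero}  i≢j = ⊥-elim (i≢j ≡.refl)
  δ-offdiag {i = zero}  {suc j} i≢j = refl
  δ-offdiag {i = suc i} {zero}  i≢j = refl
  δ-offdiag {i = suc i} {suc j} i≢j = δ-offdiag (i≢j ∘ ≡.cong suc)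

  ∑-δˡ : ∀ {n} (t : Fin (ℕ.suc n)) (g : Vector Carrier (ℕ.suc n)) → ∑[ i < ℕ.suc n ] (δ t i * g i) ≈ g t
  ∑-δˡ t g = begin
    ∑[ i < _ ] (δ t i * g i)
      ≈⟨ sum-remove {i = t} (λ i → δ t i * g i) ⟩
    δ t t * g t + ∑[ j < _ ] (δ t (punchIn t j) * g (punchIn t j))
      ≈⟨ +-cong (*-congʳ (δ-diag t)) (∑-zero _ off-diagonal) ⟩
    1# * g t + 0#
      ≈⟨ trans (+-identityʳ _) (*-identityˡ (g t)) ⟩
    g t ∎
    where
    off-diagonal : ∀ j → δ t (punchIn t j) * g (punchIn t j) ≈ 0#
    off-diagonal j = trans (*-congʳ (δ-offdiag (punchInᵢ≢i t j ∘ ≡.sym))) (zeroˡ _)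

  lincomb : ∀ {m n} → Vector Carrier m → (Fin m → Vector Carrier n) → Vector Carrier n
  lincomb cs v i = ∑[ j < _ ] (cs j * v j i)

  ⟪_,_⟫ : ∀ {n} → Vector Carrier n → Vector Carrier n → Carrier
  ⟪ w , f ⟫ = ∑[ i < _ ] (w i * f i)

  Independent : ∀ {m n} → (Fin m → Vector Carrier n) → Set (c ⊔ ℓ)
  Independent v = ∀ cs → (∀ i → lincomb cs v i ≈ 0#) → ∀ j → cs j ≈ 0#

  pairing-lincomb : ∀ {m n} cs (v : Fin m → Vector Carrier n) f →
                    ⟪ lincomb cs v , f ⟫ ≈ ∑[ j < m ] (cs j * ⟪ v j , f ⟫)
  pairing-lincomb {m} {n} cs v f = begin
    ∑[ i < n ] (lincomb cs v i * f i)
      ≈⟨ sum-cong-≋ {n} (λ i → *-distribʳ-sum (f i) (λ j → cs j * v j i)) ⟩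
    ∑[ i < n ] ∑[ j < m ] (cs j * v j i * f i)
      ≈⟨ ∑-comm (λ i j → cs j * v j i * f i) ⟩
    ∑[ j < m ] ∑[ i < n ] (cs j * v j i * f i)
      ≈⟨ sum-cong-≋ {m} (λ j → sum-cong-≋ {n} λ i → *-assoc (cs j) _ _) ⟩
    ∑[ j < m ] ∑[ i < n ] (cs j * (v j i * f i))
      ≈⟨ sum-cong-≋ {m} (λ j → *-distribˡ-sum (cs j) (λ i → v j i * f i)) ⟨
    ∑[ j < m ] (cs j * ⟪ v j , f ⟫) ∎

  lincomb-sub : ∀ {m n} d e (v : Fin m → Vector Carrier n) i →
                lincomb (λ j → d j - e j) v i ≈ lincomb d v i - lincomb e v i
  lincomb-sub {m} d e v i = begin
    ∑[ j < m ] ((d j - e j) * v j i)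
      ≈⟨ sum-cong-≋ (λ j → [y-z]x≈yx-zx (v j i) (d j) (e j)) ⟩
    ∑[ j < m ] (d j * v j i - e j * v j i)
      ≈⟨ ∑-distrib-+ (λ j → d j * v j i) (λ j → - (e j * v j i)) ⟩
    lincomb d v i + ∑[ j < m ] (- (e j * v j i))
      ≈⟨ +-congˡ (∑-neg (λ j → e j * v j i)) ⟩
    lincomb d v i - lincomb e v i ∎

  removeAt-independent⇒agree : ∀ {m n} {v : Fin (ℕ.suc m) → Vector Carrier n} {p} →
                               Independent (removeAt v p) → ∀ {d e} →
                               (∀ i → lincomb d v i ≈ lincomb e v i) → d p ≈ e p → ∀ j → d j ≈ e j
  removeAt-independent⇒agree {v = v} {p} ind {d} {e} same dp≈ep j with p ≟ j
  ... | yes ≡.refl = dp≈ep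
  ... | no  p≢j    = x∙y⁻¹≈ε⇒x≈y _ _
    (≡.subst (λ k → diff k ≈ 0#) (punchIn-punchOut p≢j) (ind (removeAt diff p) rest (punchOut p≢j)))
    where
    diff : Vector Carrier _
    diff k = d k - e k
    rest : ∀ i → lincomb (removeAt diff p) (removeAt v p) i ≈ 0#
    rest i = begin
      lincomb (removeAt diff p) (removeAt v p) i
        ≈⟨ +-identityˡ _ ⟨
      0# + lincomb (removeAt diff p) (removeAt v p) i
        ≈⟨ +-congʳ (trans (*-congʳ (x≈y⇒x∙y⁻¹≈ε dp≈ep)) (zeroˡ _)) ⟨
      diff p * v p i + lincomb (removeAt diff p) (removeAt v p) i
        ≈⟨ sum-remove {i = p} (λ k → diff k * v k i) ⟨
      lincomb diff v i
        ≈⟨ lincomb-sub d e v i ⟩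
      lincomb d v i - lincomb e v i
        ≈⟨ x≈y⇒x∙y⁻¹≈ε (same i) ⟩
      0# ∎

  Pivot : ∀ {m n} → (Fin (ℕ.suc m) → Vector Carrier (ℕ.suc n)) → Fin (ℕ.suc m) → Vector Carrier m → Set ℓ
  Pivot v p μ = ∀ j → μ j * v p zero + v (punchIn p j) zero ≈ 0#

  pivot-at-zero : ∀ {m n} {v : Fin (ℕ.suc m) → Vector Carrier (ℕ.suc n)} {p} →
                  (∀ q → v q zero ≈ 0#) → Pivot v p (λ _ → 0#)
  pivot-at-zero {p = p} column≈0 j = trans (+-cong (zeroˡ _) (column≈0 (punchIn p j))) (+-identityˡ 0#)

  eliminate : ∀ {m n} → (Fin (ℕ.suc m) → Vector Carrier (ℕ.suc n)) → Fin (ℕ.suc m) → Vector Carrier m →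
              Fin m → Vector Carrier n
  eliminate v p μ j i = μ j * v p (suc i) + v (punchIn p j) (suc i)

  lincomb-insertAt : ∀ {m n} (v : Fin (ℕ.suc m) → Vector Carrier n) p (μ cs : Vector Carrier m) i →
                     lincomb (insertAt cs p (∑[ j < m ] (cs j * μ j))) v i ≈
                     ∑[ j < m ] (cs j * (μ j * v p i + v (punchIn p j) i))
  lincomb-insertAt {m} v p μ cs i = begin
    lincomb cs′ v i
      ≈⟨ sum-remove {i = p} (λ k → cs′ k * v k i) ⟩
    cs′ p * v p i + ∑[ j < m ] (cs′ (punchIn p j) * v (punchIn p j) i)
      ≈⟨ +-cong (*-congʳ (reflexive (insertAt-lookup cs p _)))
                (sum-cong-≋ λ j → *-congʳ (reflexive (insertAt-punchIn cs p _ j))) ⟩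
    ∑[ j < m ] (cs j * μ j) * v p i + ∑[ j < m ] (cs j * v (punchIn p j) i)
      ≈⟨ +-congʳ (*-distribʳ-sum (v p i) (λ j → cs j * μ j)) ⟩
    ∑[ j < m ] (cs j * μ j * v p i) + ∑[ j < m ] (cs j * v (punchIn p j) i)
      ≈⟨ ∑-distrib-+ (λ j → cs j * μ j * v p i) (λ j → cs j * v (punchIn p j) i) ⟨
    ∑[ j < m ] (cs j * μ j * v p i + cs j * v (punchIn p j) i)
      ≈⟨ sum-cong-≋ (λ j → trans (+-congʳ (*-assoc _ _ _)) (sym (distribˡ (cs j) _ _))) ⟩
    ∑[ j < m ] (cs j * (μ j * v p i + v (punchIn p j) i)) ∎
    where
    cs′ : Vector Carrier (ℕ.suc m)
    cs′ = insertAt cs p (∑[ j < m ] (cs j * μ j))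

  eliminate-independent : ∀ {m n} {v : Fin (ℕ.suc m) → Vector Carrier (ℕ.suc n)} {p} {μ : Vector Carrier m} →
                          Pivot v p μ → Independent v → Independent (eliminate v p μ)
  eliminate-independent {m} {v = v} {p} {μ} piv ind cs relation j = begin
    cs j              ≡⟨ insertAt-punchIn cs p _ j ⟨
    cs′ (punchIn p j) ≈⟨ ind cs′ lifted (punchIn p j) ⟩
    0#                ∎
    where
    cs′ : Vector Carrier (ℕ.suc m)
    cs′ = insertAt cs p (∑[ j < m ] (cs j * μ j))
    lifted : ∀ i → lincomb cs′ v i ≈ 0#
    lifted zero    = trans (lincomb-insertAt v p μ cs zero) (∑-zero _ λ j → trans (*-congˡ (piv j)) (zeroʳ _))
    lifted (suc i) = trans (lincomb-insertAt v p μ cs (suc i)) (relation i)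

module LinearAlgebra {c ℓ : Level} (D : DivisionRing c ℓ) where
  open DivisionRing D hiding (zero)
  open LinearCombinations ring public
  open import Algebra.Properties.Ring ring using (-‿distribˡ-*)
  open import Algebra.Properties.Semiring.Sum semiring using (sum-syntax)
  open import Relation.Binary.Reasoning.Setoid setoid

  x*y≈0⇒x≈0 : ∀ {x y} → ¬ y ≈ 0# → x * y ≈ 0# → x ≈ 0#
  x*y≈0⇒x≈0 {x} {y} y≉0 xy≈0 = begin
    x             ≈⟨ *-identityʳ x ⟨
    x * 1#        ≈⟨ *-congˡ (proj₁ (proj₂ (inverse y y≉0))) ⟨
    x * (y * y⁻¹) ≈⟨ *-assoc x y y⁻¹ ⟨
    x * y * y⁻¹   ≈⟨ *-congʳ xy≈0 ⟩
    0# * y⁻¹      ≈⟨ zeroˡ y⁻¹ ⟩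
    0#            ∎
    where y⁻¹ = proj₁ (inverse y y≉0)

  solve-α*a+b≈0 : ∀ {a} → ¬ a ≈ 0# → ∀ b → ∃ λ α → α * a + b ≈ 0#
  solve-α*a+b≈0 {a} a≉0 b = - (b * a⁻¹) , (begin
    - (b * a⁻¹) * a + b   ≈⟨ +-congʳ (-‿distribˡ-* (b * a⁻¹) a) ⟨
    - (b * a⁻¹ * a) + b   ≈⟨ +-congʳ (-‿cong (*-assoc b a⁻¹ a)) ⟩
    - (b * (a⁻¹ * a)) + b ≈⟨ +-congʳ (-‿cong (*-congˡ (proj₂ (proj₂ (inverse a a≉0))))) ⟩
    - (b * 1#) + b        ≈⟨ +-congʳ (-‿cong (*-identityʳ b)) ⟩
    - b + b               ≈⟨ -‿inverseˡ b ⟩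
    0#                    ∎)
    where a⁻¹ = proj₁ (inverse a a≉0)

  independent⇒nonzero : ∀ {m n} {v : Fin (ℕ.suc m) → Vector Carrier n} → Independent v →
                        ∀ j → ¬ (∀ i → v j i ≈ 0#)
  independent⇒nonzero {v = v} ind j vj≈0 =
    1≉0 (trans (sym (δ-diag j)) (ind (δ j) (λ i → trans (∑-δˡ j (λ k → v k i)) (vj≈0 i)) j))

  removeAt-independent⇒nonzero : ∀ {m n} {v : Fin (ℕ.suc (ℕ.suc m)) → Vector Carrier n} →
                                 (∀ p → Independent (removeAt v p)) → ∀ j → ¬ (∀ i → v j i ≈ 0#)
  removeAt-independent⇒nonzero {v = v} ind j vj≈0 =
    independent⇒nonzero {v = removeAt v p} (ind p) (punchOut p≢j)
      (≡.subst (λ w → ∀ i → w i ≈ 0#) (≡.sym (removeAt-punchOut v p≢j)) vj≈0)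
    where
    p = punchIn j zero
    p≢j = punchInᵢ≢i j zero

  pivot-at-nonzero : ∀ {m n} {v : Fin (ℕ.suc m) → Vector Carrier (ℕ.suc n)} {p} →
                     ¬ v p zero ≈ 0# → ∃ (Pivot v p)
  pivot-at-nonzero {v = v} {p} vp≉0 = (λ j → proj₁ (solve j)) , (λ j → proj₂ (solve j))
    where solve = λ j → solve-α*a+b≈0 vp≉0 (v (punchIn p j) zero)

  -- Equality in D is not decidable, so a pivot is only found under double negation.
  pivot : ∀ {m n} (v : Fin (ℕ.suc m) → Vector Carrier (ℕ.suc n)) → ¬ ¬ ∃₂ (Pivot v)
  pivot {m} v ∄pivot = ¬¬-excluded-middle {A = ∃ λ p → ¬ v p zero ≈ 0#} λ where
    (yes (p , vp≉0)) → ∄pivot (p , pivot-at-nonzero {v = v} vp≉0)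
    (no  ∄nonzero)   → ¬¬-∀-Fin (ℕ.suc m) (λ q vq≉0 → ∄nonzero (q , vq≉0))
                         λ column≈0 → ∄pivot (zero , (λ _ → 0#) , pivot-at-zero {v = v} column≈0)

  overfull⇒¬independent : ∀ {n} (v : Fin (ℕ.suc n) → Vector Carrier n) → ¬ Independent v
  overfull⇒¬independent {ℕ.zero}  v ind = 1≉0 (ind (λ _ → 1#) (λ ()) zero)
  overfull⇒¬independent {ℕ.suc n} v ind = pivot v λ (p , μ , piv) →
    overfull⇒¬independent (eliminate v p μ) (eliminate-independent {v = v} piv ind)

  δ∷-independent : ∀ {n} {v : Fin n → Vector Carrier n} {f t} → Independent v →
                   (∀ m → ⟪ v m , f ⟫ ≈ 0#) → ¬ f t ≈ 0# → Independent (δ t Vector.∷ v)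
  δ∷-independent {ℕ.suc n} {v} {f} {t} ind v⊥f ft≉0 cs relation = coefficient
    where
    w = δ t Vector.∷ v
    head≈0 : cs zero ≈ 0#
    head≈0 = x*y≈0⇒x≈0 ft≉0 (begin
      cs zero * f t
        ≈⟨ *-congˡ (∑-δˡ t f) ⟨
      cs zero * ⟪ δ t , f ⟫
        ≈⟨ +-identityʳ _ ⟨
      cs zero * ⟪ δ t , f ⟫ + 0#
        ≈⟨ +-congˡ (∑-zero (λ m → cs (suc m) * ⟪ v m , f ⟫) λ m → trans (*-congˡ (v⊥f m)) (zeroʳ _)) ⟨
      ∑[ m < ℕ.suc (ℕ.suc n) ] (cs m * ⟪ w m , f ⟫)
        ≈⟨ pairing-lincomb cs w f ⟨
      ⟪ lincomb cs w , f ⟫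
        ≈⟨ ∑-zero (λ i → lincomb cs w i * f i) (λ i → trans (*-congʳ (relation i)) (zeroˡ _)) ⟩
      0# ∎)
    tail-relation : ∀ i → lincomb (cs ∘ suc) v i ≈ 0#
    tail-relation i = begin
      lincomb (cs ∘ suc) v i                    ≈⟨ +-identityˡ _ ⟨
      0# + lincomb (cs ∘ suc) v i               ≈⟨ +-congʳ (trans (*-congʳ head≈0) (zeroˡ _)) ⟨
      cs zero * δ t i + lincomb (cs ∘ suc) v i  ≈⟨ relation i ⟩
      0#                                        ∎
    coefficient : ∀ j → cs j ≈ 0#
    coefficient zero    = head≈0
    coefficient (suc m) = ind (cs ∘ suc) tail-relation m

  independent⇒¬annihilated : ∀ {n} {v : Fin n → Vector Carrier n} {f} → Independent v →
                             ¬ (∀ t → f t ≈ 0#) → ¬ (∀ m → ⟪ v m , f ⟫ ≈ 0#)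
  independent⇒¬annihilated {n} {v} {f} ind f≉0 v⊥f = ¬¬-∀-Fin n (λ t ft≉0 →
    overfull⇒¬independent (δ t Vector.∷ v) (δ∷-independent {v = v} {f} ind v⊥f ft≉0)) f≉0

opposite : ∀ {c ℓ} → DivisionRing c ℓ → DivisionRing c ℓ
opposite D = record
  { ring    = Op.ring ring
  ; 1≉0     = 1≉0
  ; inverse = λ x x≉0 → let (y , xy≈1 , yx≈1) = inverse x x≉0 in y , yx≈1 , xy≈1
  }
  where open DivisionRing D

AtMostThree : ∀ {p} → (Fin 5 → Set p) → Set p
AtMostThree P = ∀ (s : Fin 4 → Fin 5) → Injective _≡_ _≡_ s → ¬ (∀ q → P (s q))

common-gap : ∀ {p} {P Q : Fin 5 → Set p} → Decidable P → Decidable Q → AtMostThree P → AtMostThree Q →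
             ∀ {k l} → k ≢ l → P k → P l → Q k → Q l → ∃ λ m → ¬ P m × ¬ Q m
common-gap {P = P} {Q} P? Q? P≤3 Q≤3 {k} {l} k≢l Pk Pl Qk Ql with any? (λ m → ¬? (P? m) ×-dec ¬? (Q? m))
... | yes gap  = gap
... | no  ∄gap = ⊥-elim (split (cover (# 0)) (cover (# 1)) (cover (# 2)))
  where
  -- the three points other than k and l
  e : Fin 3 → Fin 5
  e q = punchIn k (punchIn (punchOut k≢l) q)

  cover : ∀ q → P (e q) ⊎ Q (e q)
  cover q with P? (e q) | Q? (e q)
  ... | yes p | _      = inj₁ p
  ... | no  _ | yes q′ = inj₂ q′
  ... | no ¬p | no ¬q  = ⊥-elim (∄gap (e q , ¬p , ¬q))

  k≢e : ∀ q → k ≢ e q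
  k≢e q = punchInᵢ≢i k _ ∘ ≡.sym

  l≢e : ∀ q → l ≢ e q
  l≢e q l≡eq = punchInᵢ≢i (punchOut k≢l) q
    (≡.sym (punchIn-injective k _ _ (≡.trans (punchIn-punchOut k≢l) l≡eq)))

  e-injective : ∀ {q r} → q ≢ r → e q ≢ e r
  e-injective q≢r = q≢r ∘ punchIn-injective _ _ _ ∘ punchIn-injective k _ _

  four : ∀ {R : Fin 5 → Set _} → AtMostThree R → R k → R l → ∀ {q r} → q ≢ r → R (e q) → R (e r) → ⊥
  four {R} R≤3 Rk Rl {q} {r} q≢r Rq Rr =
    R≤3 (lookup points) (lookup-injective distinct _ _) (lookup⁺ {P = R} {xs = points} (Rk ∷ Rl ∷ Rq ∷ Rr ∷ []))
    where
    points = k ∷ l ∷ e q ∷ e r ∷ []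
    distinct : Unique points
    distinct = (k≢l ∷ k≢e q ∷ k≢e r ∷ []) ∷ (l≢e q ∷ l≢e r ∷ []) ∷ (e-injective q≢r ∷ []) ∷ [] ∷ []

  split : P (e (# 0)) ⊎ Q (e (# 0)) → P (e (# 1)) ⊎ Q (e (# 1)) → P (e (# 2)) ⊎ Q (e (# 2)) → ⊥
  split (inj₁ p₀) (inj₁ p₁) _         = four P≤3 Pk Pl {# 0} {# 1} (λ ()) p₀ p₁
  split (inj₂ q₀) (inj₂ q₁) _         = four Q≤3 Qk Ql {# 0} {# 1} (λ ()) q₀ q₁
  split (inj₁ p₀) (inj₂ _)  (inj₁ p₂) = four P≤3 Pk Pl {# 0} {# 2} (λ ()) p₀ p₂
  split (inj₂ q₀) (inj₁ _)  (inj₂ q₂) = four Q≤3 Qk Ql {# 0} {# 2} (λ ()) q₀ q₂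
  split (inj₁ _)  (inj₂ q₁) (inj₂ q₂) = four Q≤3 Qk Ql {# 1} {# 2} (λ ()) q₁ q₂
  split (inj₂ _)  (inj₁ p₁) (inj₁ p₂) = four P≤3 Pk Pl {# 1} {# 2} (λ ()) p₁ p₂

module Configuration {c ℓ : Level} (D : DivisionRing c ℓ) where
  open DivisionRing D hiding (zero)
  open LinAlg D
  open LinearAlgebra D
  -- W* is a right D-space, that is, a left space over the opposite ring.
  module ᵒᵖ = LinearAlgebra (opposite D)
  open import Algebra.Properties.Semiring.Sum semiring
    using (sum-syntax; sum-cong-≋; ∑-distrib-+; *-distribˡ-sum)
  open import Relation.Binary.Reasoning.Setoid setoid

  Σ4≈∑ : ∀ g → Σ4 g ≈ ∑[ i < 4 ] g i
  Σ4≈∑ g = +-congˡ (+-congˡ (+-congˡ (sym (+-identityʳ _))))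

  Σ5≈∑ : ∀ g → Σ5 g ≈ ∑[ i < 5 ] g i
  Σ5≈∑ g = +-congˡ (Σ4≈∑ (g ∘ suc))

  ⟨lincomb5,_⟩ : ∀ g (x : Fin 5 → W) f → ⟨ lincomb5 g x , f ⟩ ≈ ∑[ j < 5 ] (g j * ⟨ x j , f ⟩)
  ⟨lincomb5,_⟩ g x f = begin
    ⟨ lincomb5 g x , f ⟩
      ≈⟨ Σ4≈∑ (λ t → lincomb5 g x t * f t) ⟩
    ⟪ lincomb5 g x , f ⟫
      ≈⟨ sum-cong-≋ {4} (λ t → *-congʳ {f t} (Σ5≈∑ (λ j → g j * x j t))) ⟩
    ⟪ lincomb g x , f ⟫
      ≈⟨ pairing-lincomb g x f ⟩
    ∑[ j < 5 ] (g j * ⟪ x j , f ⟫)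
      ≈⟨ sum-cong-≋ {5} (λ j → *-congˡ {g j} (Σ4≈∑ (λ t → x j t * f t))) ⟨
    ∑[ j < 5 ] (g j * ⟨ x j , f ⟩) ∎

  u∈Span2 : ∀ u v → Span2 u v u
  u∈Span2 u v = 1# , 0# , λ t → sym (trans (+-cong (*-identityˡ _) (zeroˡ _)) (+-identityʳ _))

  v∈Span2 : ∀ u v → Span2 u v v
  v∈Span2 u v = 0# , 1# , λ t → sym (trans (+-cong (zeroˡ _) (*-identityˡ _)) (+-identityˡ _))

  f∈Span2* : ∀ f g → Span2* f g f
  f∈Span2* f g = 1# , 0# , λ t → sym (trans (+-cong (*-identityʳ _) (zeroʳ _)) (+-identityʳ _))

  g∈Span2* : ∀ f g → Span2* f g g
  g∈Span2* f g = 0# , 1# , λ t → sym (trans (+-cong (zeroʳ _) (*-identityʳ _)) (+-identityˡ _))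

  Span2-same-pair : ∀ (x : Fin 5 → W) {i j i′ j′} → i′ ≢ j′ → i′ ≡ i ⊎ i′ ≡ j → j′ ≡ i ⊎ j′ ≡ j →
                    Span2 (x i) (x j) ≐ Span2 (x i′) (x j′)
  Span2-same-pair x i′≢j′ (inj₁ ≡.refl) (inj₁ ≡.refl) = ⊥-elim (i′≢j′ ≡.refl)
  Span2-same-pair x i′≢j′ (inj₂ ≡.refl) (inj₂ ≡.refl) = ⊥-elim (i′≢j′ ≡.refl)
  Span2-same-pair x i′≢j′ (inj₁ ≡.refl) (inj₂ ≡.refl) = (λ w h → h) , (λ w h → h)
  Span2-same-pair x i′≢j′ (inj₂ ≡.refl) (inj₁ ≡.refl) = swap , swap
    where
    swap : ∀ {u v} w → Span2 u v w → Span2 v u w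
    swap w (r , s , w≈) = s , r , λ t → trans (w≈ t) (+-comm _ _)

  module _ (x : Fin 5 → W) (y : Fin 5 → W*) (x-indep : FourIndependent x) (y-indep : FourIndependent* y)
           (U≐span : ∀ k → Σ (Subset 5) λ S → Ann1 (y k) ≐ SpanOf x S) where

    S : Fin 5 → Subset 5
    S k = proj₁ (U≐span k)

    x-independent : ∀ s → Injective _≡_ _≡_ s → Independent (x ∘ s)
    x-independent s s-inj cs relation =
      proj₂ x-indep s s-inj cs λ i → trans (Σ4≈∑ (λ j → cs j * x (s j) i)) (relation i)

    y-independent : ∀ s → Injective _≡_ _≡_ s → ᵒᵖ.Independent (y ∘ s)
    y-independent s s-inj cs relation =
      proj₂ y-indep s s-inj cs λ i → trans (Σ4≈∑ (λ j → y (s j) i * cs j)) (relation i)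

    x-nonzero : ∀ j → ¬ (∀ t → x j t ≈ 0#)
    x-nonzero = removeAt-independent⇒nonzero λ p → x-independent (punchIn p) (punchIn-injective p _ _)

    y-nonzero : ∀ k → ¬ (∀ t → y k t ≈ 0#)
    y-nonzero = ᵒᵖ.removeAt-independent⇒nonzero λ p → y-independent (punchIn p) (punchIn-injective p _ _)

    y-vanishes-on-at-most-three : ∀ k → AtMostThree (λ j → ⟨ x j , y k ⟩ ≈ 0#)
    y-vanishes-on-at-most-three k s s-inj x⊥y =
      independent⇒¬annihilated {v = x ∘ s} (x-independent s s-inj) (y-nonzero k)
        λ q → trans (sym (Σ4≈∑ (λ t → x (s q) t * y k t))) (x⊥y q)

    x-annihilated-by-at-most-three : ∀ i → AtMostThree (λ k → ⟨ x i , y k ⟩ ≈ 0#)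
    x-annihilated-by-at-most-three i s s-inj x⊥y =
      ᵒᵖ.independent⇒¬annihilated {v = y ∘ s} (y-independent s s-inj) (x-nonzero i)
        λ q → trans (sym (Σ4≈∑ (λ t → x i t * y (s q) t))) (x⊥y q)

    ∈S⇒orthogonal : ∀ {j k} → j ∈ S k → ⟨ x j , y k ⟩ ≈ 0#
    ∈S⇒orthogonal {j} {k} j∈S = lower (proj₂ (proj₂ (U≐span k)) (x j) (δ j , δ-outside , x≈δ))
      where
      δ-outside : ∀ l → l ∉ S k → δ j l ≈ 0#
      δ-outside l l∉S = δ-offdiag {i = j} {l} λ { ≡.refl → l∉S j∈S }
      x≈δ : x j ≈W lincomb5 (δ j) x
      x≈δ i = sym (trans (Σ5≈∑ (λ l → δ j l * x l i)) (∑-δˡ j (λ l → x l i)))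

    -- ∑ g_j x_j ∈ U_k also has a representation supported on S k; the two agree at m, hence everywhere.
    kernel-coefficients : ∀ k g → ∑[ j < 5 ] (g j * ⟨ x j , y k ⟩) ≈ 0# →
                          ∀ {m} → m ∉ S k → g m ≈ 0# → ∀ {j} → j ∉ S k → g j ≈ 0#
    kernel-coefficients k g orthogonal {m} m∉S gm≈0 {j} j∉S
      with proj₁ (proj₂ (U≐span k)) (lincomb5 g x) (lift (trans (⟨lincomb5, g ⟩ x (y k)) orthogonal))
    ... | cs , cs-outside , g≈cs = trans (agree j) (cs-outside j j∉S)
      where
      agree : ∀ j → g j ≈ cs j
      agree = removeAt-independent⇒agree {v = x} (x-independent (punchIn m) (punchIn-injective m _ _))
        (λ i → trans (sym (Σ5≈∑ (λ l → g l * x l i))) (trans (g≈cs i) (Σ5≈∑ (λ l → cs l * x l i))))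
        (trans gm≈0 (sym (cs-outside m m∉S)))

    orthogonal⇒∈S : ∀ {i k} → ⟨ x i , y k ⟩ ≈ 0# → i ∈ S k
    orthogonal⇒∈S {i} {k} x⊥y with i ∈? S k
    ... | yes i∈S = i∈S
    ... | no  i∉S with any? (λ m → ¬? (m ≟ i) ×-dec ¬? (m ∈? S k))
    ...   | yes (m , m≢i , m∉S) = ⊥-elim (1≉0 (trans (sym (δ-diag i)) δii≈0))
      where
      δii≈0 : δ i i ≈ 0#
      δii≈0 = kernel-coefficients k (δ i) (trans (∑-δˡ i (λ j → ⟨ x j , y k ⟩)) x⊥y)
                m∉S (δ-offdiag (m≢i ∘ ≡.sym)) i∉S
    ...   | no  ∄m =
      ⊥-elim (y-vanishes-on-at-most-three k (punchIn i) (punchIn-injective i _ _) (∈S⇒orthogonal ∘ others∈S))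
      where
      others∈S : ∀ q → punchIn i q ∈ S k
      others∈S q = decidable-stable (punchIn i q ∈? S k) λ ∉S → ∄m (punchIn i q , punchInᵢ≢i i q , ∉S)

    -- α x_a + x_b lies in U_k, has coefficient 1 at b ∉ S k and coefficient 0 at e ∉ S k.
    outside-S-at-most-two : ∀ k {a b e} → a ≢ b → a ≢ e → b ≢ e → a ∉ S k → b ∉ S k → e ∉ S k → ⊥
    outside-S-at-most-two k {a} {b} {e} a≢b a≢e b≢e a∉S b∉S e∉S =
      1≉0 (trans (sym g-b) (kernel-coefficients k g orthogonal e∉S g-e b∉S))
      where
      pairing : Fin 5 → Carrier
      pairing j = ⟨ x j , y k ⟩
      solution = solve-α*a+b≈0 (a∉S ∘ orthogonal⇒∈S) (pairing b)
      α = proj₁ solution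
      g : Fin 5 → Carrier
      g j = α * δ a j + δ b j
      g-b : g b ≈ 1#
      g-b = trans (+-cong (trans (*-congˡ (δ-offdiag a≢b)) (zeroʳ α)) (δ-diag b)) (+-identityˡ 1#)
      g-e : g e ≈ 0#
      g-e = trans (+-cong (trans (*-congˡ (δ-offdiag a≢e)) (zeroʳ α)) (δ-offdiag b≢e)) (+-identityˡ 0#)
      orthogonal : ∑[ j < 5 ] (g j * pairing j) ≈ 0#
      orthogonal = begin
        ∑[ j < 5 ] (g j * pairing j)
          ≈⟨ sum-cong-≋ {5} (λ j → trans (distribʳ (pairing j) (α * δ a j) (δ b j))
                                          (+-congʳ (*-assoc α (δ a j) (pairing j)))) ⟩
        ∑[ j < 5 ] (α * (δ a j * pairing j) + δ b j * pairing j)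
          ≈⟨ ∑-distrib-+ (λ j → α * (δ a j * pairing j)) (λ j → δ b j * pairing j) ⟩
        ∑[ j < 5 ] (α * (δ a j * pairing j)) + ∑[ j < 5 ] (δ b j * pairing j)
          ≈⟨ +-cong (sym (*-distribˡ-sum α (λ j → δ a j * pairing j))) (∑-δˡ b pairing) ⟩
        α * ∑[ j < 5 ] (δ a j * pairing j) + pairing b
          ≈⟨ +-congʳ (*-congˡ (∑-δˡ a pairing)) ⟩
        α * pairing a + pairing b
          ≈⟨ proj₂ solution ⟩
        0# ∎

    ∈S-at-most-three : ∀ i → AtMostThree (λ k → i ∈ S k)
    ∈S-at-most-three i s s-inj i∈S = x-annihilated-by-at-most-three i s s-inj (∈S⇒orthogonal ∘ i∈S)

    InZ⇒gap : ∀ {i j} → InZ x y i j → ∃ λ m → i ∉ S m × j ∉ S m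
    InZ⇒gap {i} {j} (_ , k , l , k≢l , span≐ann) =
      common-gap (λ m → i ∈? S m) (λ m → j ∈? S m) (∈S-at-most-three i) (∈S-at-most-three j) k≢l
        (orthogonal⇒∈S (orth (u∈Span2 _ _) (f∈Span2* _ _))) (orthogonal⇒∈S (orth (u∈Span2 _ _) (g∈Span2* _ _)))
        (orthogonal⇒∈S (orth (v∈Span2 _ _) (f∈Span2* _ _))) (orthogonal⇒∈S (orth (v∈Span2 _ _) (g∈Span2* _ _)))
      where
      orth : ∀ {w h} → Span2 (x i) (x j) w → Span2* (y k) (y l) h → ⟨ w , h ⟩ ≈ 0#
      orth w∈ h∈ = proj₁ span≐ann _ w∈ _ h∈

    complement-pair : ∀ {m i j u} → i ≢ j → i ∉ S m → j ∉ S m → u ∉ S m → u ≡ i ⊎ u ≡ j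
    complement-pair {m} {i} {j} {u} i≢j i∉S j∉S u∉S with u ≟ i | u ≟ j
    ... | yes u≡i | _       = inj₁ u≡i
    ... | no  _   | yes u≡j = inj₂ u≡j
    ... | no  u≢i | no  u≢j = ⊥-elim (outside-S-at-most-two m i≢j (u≢i ∘ ≡.sym) (u≢j ∘ ≡.sym) i∉S j∉S u∉S)

    gap-determines-span : ∀ {m m′ i j i′ j′} → m ≡ m′ → i ≢ j → i′ ≢ j′ →
                          i ∉ S m → j ∉ S m → i′ ∉ S m′ → j′ ∉ S m′ →
                          Span2 (x i) (x j) ≐ Span2 (x i′) (x j′)
    gap-determines-span ≡.refl i≢j i′≢j′ i∉S j∉S i′∉S j′∉S =
      Span2-same-pair x i′≢j′ (complement-pair i≢j i∉S j∉S i′∉S) (complement-pair i≢j i∉S j∉S j′∉S)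

    Z-at-most-five : ZAtMostFive x y
    Z-at-most-five (f , f∈Z , f-distinct) =
      let (p , q , p<q , same-gap) = pigeonhole (n<1+n 5) (proj₁ ∘ gap)
          (_ , i∉S , j∉S) = gap p
          (_ , i′∉S , j′∉S) = gap q
      in f-distinct p q (<⇒≢ p<q)
           (gap-determines-span same-gap (proj₁ (f∈Z p)) (proj₁ (f∈Z q)) i∉S j∉S i′∉S j′∉S)
      where
      gap : ∀ p → ∃ λ m → proj₁ (f p) ∉ S m × proj₂ (f p) ∉ S m
      gap p = InZ⇒gap (f∈Z p)

lemma4p7 : ∀ {c ℓ : Level} (D : DivisionRing c ℓ) → let open LinAlg D in
    (x : Fin 5 → W) (y : Fin 5 → W*) →
    FourIndependent x → FourIndependent* y →
    (∀ i → Σ (Subset 5) λ S → Ann1 (y i) ≐ SpanOf x S) →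
    (∀ i → Σ (Subset 5) λ T → Span1 (x i) ≐ InterAnn y T) →
    ZAtMostFive x y × (5 < 7) × (a 5 2 ≡ 7)
lemma4p7 D x y x-indep y-indep U≐span _ =
  Configuration.Z-at-most-five D x y x-indep y-indep U≐span , n≤1+n 6 , ≡.refl
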